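{- Let $S$ be a concentrated deque sequence of length $m$ on $[n]$ and let $P$ be the point set produced by \textsc{Greedy} on $S$. Then $P$ avoids the pattern $P_5$; that is, there do not exist points $a,b,c,d,e\in P$ with $a_x<b_x<c_x<d_x<e_x$, $a_t=c_t=e_t$, $b_t=d_t$, and $b_t<a_t$.
   Context: Update sequences. An update sequence of length $m$ on $[n]$ is $S=\langle (s_1,\mathrm{op}_1),\dots,(s_m,\mathrm{op}_m)\rangle$ with $s_t\in[n]$, $\mathrm{op}_t\in\{\mathtt{access},\mathtt{insert},\mathtt{delete}\}$; standing assumptions: for each element its insertions and deletions alternate along $S$, and every $x\in[n]$ occurs in $S$. Let $K_0$ be the set of elements whose first operation is not an insertion, $K_t=K_{t-1}\cup\{s_t\}$ if $\mathrm{op}_t=\mathtt{insert}$, $K_t=K_{t-1}\setminus\{s_t\}$ if $\mathtt{delete}$, $K_t=K_{t-1}$ otherwise. $S$ is a deque sequence if it has no accesses, each insertion at time $t$ has $s_t\in\{\min K_t,\max K_t\}$, and each deletion at time $t$ has $s_t\in\{\min K_{t-1},\max K_{t-1}\}$. Let $L_t$ be the set of $s_{t'}$ with $t'<t$, $\mathrm{op}_{t'}=\mathtt{delete}$ and $s_{t'}=\min K_{t'-1}$, and $R_t$ the set of $s_{t'}$ with $t'<t$, $\mathrm{op}_{t'}=\mathtt{delete}$ and $s_{t'}\ne\min K_{t'-1}$. A deque sequence is concentrated if for every insertion time $t$: if $s_t=\min K_t$ then $y<s_t$ for all $y\in L_t$, and if $s_t=\max K_t$ then $s_t<y$ for all $y\in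 R_t$. Geometric view. Points $p=(p_x,p_t)\in[n]\times[m]$ (column = element, row = time). $I=\{(s_t,t):\mathrm{op}_t=\mathtt{insert}\}$, $D=\{(s_t,t):\mathrm{op}_t=\mathtt{delete}\}$, $U=I\cup D$. For a point $p$, let $p'$ (resp. $p''$) be the point of $U$ in column $p_x$ with largest time $<p_t$ (resp. smallest time $>p_t$), if it exists. $p$ is valid iff (1) $p\notin U$, $p'\in I$ or nonexistent, $p''\in D$ or nonexistent; or (2) $p\in I$, $p'\in D$ or nonexistent, $p''\in D$ or nonexistent; or (3) $p\in D$, $p'\in I$ or nonexistent, $p''\in I$ or nonexistent. The active time of a valid $p$ is the maximal interval of consecutive integers containing $p_t$ on which $(p_x,t)$ is valid; $p,q$ with $p_t\le q_t$ form an active pair if $[p_t,q_t]$ lies in the active times of both. $\mathrm{pred}(p)=(x',p_t)$ with $x'$ the largest $x'<p_x$ such that $(x',p_t)$ is valid (if any); $\mathrm{succ}(p)$ symmetric. $\square_{pq}$ is the closed axis-parallel rectangle with opposite corners $p,q$. \textsc{Greedy}. It processes $t=1,\dots,m$ and builds $P$ row by row; $P_{<t}$ is the set of points placed in rows $1,\dots,t-1$. For a valid point $u$ in row $t$, $\mathrm{stair}(u)=\{u\}\cup\{q\in P_{<t}: u,q\text{ form an active pair and }\square_{uq}\cap P_{<t}=\{q\}\}$. Let $p=(s_t,t)$. If $\mathrm{op}_t=\mathtt{access}$, or not both $\mathrm{pred}(p),\mathrm{succ}(p)$ exist, row $t$ of $P$ is $\{(q_x,t):q\in\mathrm{stair}(p)\}$;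 otherwise (update point with both neighbours) row $t$ is the smaller (ties arbitrary) of $\{(q_x,t):q\in\mathrm{stair}(p)\cup\mathrm{stair}(\mathrm{pred}(p))\}$ and $\{(q_x,t):q\in\mathrm{stair}(p)\cup\mathrm{stair}(\mathrm{succ}(p))\}$. -}

module Defs where

open import Data.Nat using (ℕ; zero; suc; _≤_; _<_; _⊔_; _⊓_)
open import Data.Product using (Σ; ∃; _×_; _,_; proj₁; proj₂)
open import Data.Sum using (_⊎_)
open import Relation.Nullary using (¬_)
open import Relation.Binary.PropositionalEquality using (_≡_; _≢_)

data Op : Set where
  access insert delete : Op

-- An update sequence of length m on [n] = {1,…,n}.  Times are 1,…,m;
-- the values of s and op outside [1,m] are irrelevant (never used).
record UpdSeq (n m : ℕ) : Set where
  field
    s  : ℕ → ℕ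
    op : ℕ → Op

InRange : ℕ → ℕ → Set
InRange n x = 1 ≤ x × x ≤ n

-- Points (x , t): column x = element, row t = time.
Point : Set
Point = ℕ × ℕ

PointSet : Set₁
PointSet = Point → Set

IsUpdate : Op → Set
IsUpdate o = o ≡ insert ⊎ o ≡ delete

IsMin : (ℕ → Set) → ℕ → Set
IsMin A x = A x × (∀ y → A y → x ≤ y)

IsMax : (ℕ → Set) → ℕ → Set
IsMax A x = A x × (∀ y → A y → y ≤ x)

Card≤ : (ℕ → Set) → (ℕ → Set) → Set
Card≤ A B = Σ (ℕ → ℕ) λ f →
  (∀ x → A x → B (f x)) × (∀ x y → A x → A y → f x ≡ f y → x ≡ y)

Cols : PointSet → ℕ → Set
Cols A x = ∃ λ q → A q × proj₁ q ≡ x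

RowIs : PointSet → ℕ → (ℕ → Set) → Set
RowIs P t C = ∀ x → (P (x , t) → C x) × (C x → P (x , t))

InBox : Point → Point → Point → Set
InBox u q r =
  (proj₁ u ⊓ proj₁ q) ≤ proj₁ r × proj₁ r ≤ (proj₁ u ⊔ proj₁ q) ×
  (proj₂ u ⊓ proj₂ q) ≤ proj₂ r × proj₂ r ≤ (proj₂ u ⊔ proj₂ q)

module _ {n m : ℕ} (S : UpdSeq n m) where
  open UpdSeq S

  InTime : ℕ → Set
  InTime t = 1 ≤ t × t ≤ m

  WellFormed : Set
  WellFormed = ∀ t → InTime t → InRange n (s t)

  -- insertions and deletions of each element alternate
  Alternating : Set
  Alternating = ∀ t₁ t₂ → InTime t₁ → InTime t₂ → t₁ < t₂ →
    s t₁ ≡ s t₂ → IsUpdate (op t₁) → IsUpdate (op t₂) →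
    (∀ t → t₁ < t → t < t₂ → s t ≡ s t₁ → ¬ IsUpdate (op t)) →
    op t₁ ≢ op t₂

  AllOccur : Set
  AllOccur = ∀ x → InRange n x → ∃ λ t → InTime t × s t ≡ x

  Standing : Set
  Standing = WellFormed × Alternating × AllOccur

  FirstOp : ℕ → Op → Set
  FirstOp x o = ∃ λ t → InTime t × s t ≡ x × op t ≡ o ×
    (∀ t' → 1 ≤ t' → t' < t → s t' ≢ x)

  K0 : ℕ → Set
  K0 x = InRange n x × ∃ λ o → FirstOp x o × o ≢ insert

  Kstep : Op → ℕ → (ℕ → Set) → ℕ → Set
  Kstep insert y A x = x ≡ y ⊎ A x
  Kstep delete y A x = A x × x ≢ y
  Kstep access y A x = A x

  K : ℕ → ℕ → Set
  K zero = K0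
  K (suc t) = Kstep (op (suc t)) (s (suc t)) (K t)

  Deque : Set
  Deque =
    (∀ t → InTime t → op t ≢ access) ×
    (∀ t → InTime t → op t ≡ insert → IsMin (K t) (s t) ⊎ IsMax (K t) (s t)) ×
    (∀ t → suc t ≤ m → op (suc t) ≡ delete →
       IsMin (K t) (s (suc t)) ⊎ IsMax (K t) (s (suc t)))

  -- L_t and R_t (deletion at time suc t' uses K_{t'})
  L : ℕ → ℕ → Set
  L t y = ∃ λ t' → suc t' < t × op (suc t') ≡ delete × s (suc t') ≡ y ×
    IsMin (K t') (s (suc t'))

  R : ℕ → ℕ → Set
  R t y = ∃ λ t' → suc t' < t × op (suc t') ≡ delete × s (suc t') ≡ y ×
    ¬ IsMin (K t') (s (suc t'))

  Concentrated : Set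
  Concentrated = ∀ t → InTime t → op t ≡ insert →
    (IsMin (K t) (s t) → ∀ y → L t y → y < s t) ×
    (IsMax (K t) (s t) → ∀ y → R t y → s t < y)

  Ipt : PointSet
  Ipt (x , t) = InTime t × s t ≡ x × op t ≡ insert

  Dpt : PointSet
  Dpt (x , t) = InTime t × s t ≡ x × op t ≡ delete

  Upt : PointSet
  Upt p = Ipt p ⊎ Dpt p

  PrevU : Point → Point → Set
  PrevU p q = Upt q × proj₁ q ≡ proj₁ p × proj₂ q < proj₂ p ×
    (∀ t → proj₂ q < t → t < proj₂ p → ¬ Upt (proj₁ p , t))

  NextU : Point → Point → Set
  NextU p q = Upt q × proj₁ q ≡ proj₁ p × proj₂ p < proj₂ q ×
    (∀ t → proj₂ p < t → t < proj₂ q → ¬ Upt (proj₁ p , t))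

  -- "p' ∈ A or nonexistent" / "p'' ∈ A or nonexistent"
  PrevIn : PointSet → Point → Set
  PrevIn A p = ∀ q → PrevU p q → A q

  NextIn : PointSet → Point → Set
  NextIn A p = ∀ q → NextU p q → A q

  Valid : PointSet
  Valid p = InRange n (proj₁ p) × InTime (proj₂ p) ×
    ((¬ Upt p × PrevIn Ipt p × NextIn Dpt p) ⊎
     (Ipt p × PrevIn Dpt p × NextIn Dpt p) ⊎
     (Dpt p × PrevIn Ipt p × NextIn Ipt p))

  -- t lies in the active time of p (the maximal interval of consecutive
  -- times containing p_t on which (p_x , ·) is valid)
  InActive : Point → ℕ → Set
  InActive p t = ∀ t' → (proj₂ p ⊓ t) ≤ t' → t' ≤ (proj₂ p ⊔ t) →
    Valid (proj₁ p , t')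

  ActivePair : Point → Point → Set
  ActivePair p q = proj₂ p ≤ proj₂ q ×
    (∀ t → proj₂ p ≤ t → t ≤ proj₂ q → InActive p t × InActive q t)

  Pred : Point → Point → Set
  Pred p r = proj₂ r ≡ proj₂ p × proj₁ r < proj₁ p × Valid r ×
    (∀ x → proj₁ r < x → x < proj₁ p → ¬ Valid (x , proj₂ p))

  Succ : Point → Point → Set
  Succ p r = proj₂ r ≡ proj₂ p × proj₁ p < proj₁ r × Valid r ×
    (∀ x → proj₁ p < x → x < proj₁ r → ¬ Valid (x , proj₂ p))

  Stair : PointSet → Point → PointSet
  Stair P u q = q ≡ u ⊎
    (P q × proj₂ q < proj₂ u × ActivePair q u ×
     (∀ r → P r → proj₂ r < proj₂ u → InBox u q r → r ≡ q))

  -- P is a possible output of Greedy on S (any tie-breaking)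
  Greedy : PointSet → Set
  Greedy P =
    (∀ p → P p → InTime (proj₂ p)) ×
    (∀ t → InTime t →
      ((op t ≡ access ⊎ ¬ ((∃ λ r → Pred (s t , t) r) × (∃ λ r → Succ (s t , t) r))) →
         RowIs P t (Cols (Stair P (s t , t)))) ×
      (op t ≢ access → ∀ pl pr → Pred (s t , t) pl → Succ (s t , t) pr →
         let A = Cols (λ q → Stair P (s t , t) q ⊎ Stair P pl q)
             B = Cols (λ q → Stair P (s t , t) q ⊎ Stair P pr q)
         in (RowIs P t A × Card≤ A B) ⊎ (RowIs P t B × Card≤ B A)))

module Submission where

open import Defs
open import Data.Nat using (ℕ; _<_)
open import Data.Product using (Σ; _×_; proj₁; proj₂)
open import Relation.Nullary using (¬_)
open import Relation.Binary.PropositionalEquality using (_≡_)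

open import Data.Nat using (zero; suc; pred; _≤_; z≤n; s≤s; _⊓_; _⊔_; _≟_; _<?_; _≤?_)
open import Data.Nat using (_≤′_; ≤′-reflexive; ≤′-step)
open import Data.Nat.Properties
open import Data.Nat.Induction using (<-rec)
open import Data.Product using (_,_; ∃)
open import Data.Sum using (_⊎_; inj₁; inj₂; [_,_])
open import Data.Empty using (⊥; ⊥-elim)
open import Relation.Nullary using (Dec; yes; no)
open import Relation.Nullary.Decidable using (_×-dec_)
open import Relation.Binary.PropositionalEquality using (refl; sym; trans; subst; cong; _≢_)
open import Relation.Binary.Definitions using (tri<; tri≈; tri>)

-- Write K(t) for the key set after time t, and keyTime t for t after an
-- insertion and t − 1 before a deletion.
-- Given a P₅ pattern with b, d in row τ and a, c, e in row T, survival keeps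
-- b and d keys at all times in [τ , T], so there s t ∉ (b , d) and s t ≠ c.
-- A point (c , t), τ < t ≤ T, therefore lies above an earlier point (c , t')
-- with an empty box towards (s t , t): if t' ≤ τ the box holds (b , τ) or
-- (d , τ), otherwise we descend to t'.  Strong induction excludes (c , T).

module Search {Q : ℕ → Set} (Q? : ∀ u → Dec (Q u)) where

  lastBelow : ∀ t → (Σ ℕ λ t' → t' < t × Q t' × (∀ u → t' < u → u < t → ¬ Q u))
                  ⊎ (∀ u → u < t → ¬ Q u)
  lastBelow zero = inj₂ λ _ ()
  lastBelow (suc t) with Q? t
  ... | yes q = inj₁ (t , n<1+n t , q , λ u t<u u<1+t → ⊥-elim (≤⇒≯ (≤-pred u<1+t) t<u))
  ... | no ¬q with lastBelow t
  ...   | inj₁ (t' , t'<t , q , gap) =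
          inj₁ (t' , m<n⇒m<1+n t'<t , q , λ u t'<u u<1+t →
                  [ gap u t'<u , (λ { refl → ¬q }) ] (m<1+n⇒m<n∨m≡n u<1+t))
  ...   | inj₂ none = inj₂ λ u u<1+t → [ none u , (λ { refl → ¬q }) ] (m<1+n⇒m<n∨m≡n u<1+t)

  firstBelow : ∀ t → (Σ ℕ λ t' → t' < t × Q t' × (∀ u → u < t' → ¬ Q u))
                   ⊎ (∀ u → u < t → ¬ Q u)
  firstBelow zero = inj₂ λ _ ()
  firstBelow (suc t) with firstBelow t
  ... | inj₁ (t' , t'<t , q , earliest) = inj₁ (t' , m<n⇒m<1+n t'<t , q , earliest)
  ... | inj₂ none with Q? t
  ...   | yes q = inj₁ (t , n<1+n t , q , none)
  ...   | no ¬q = inj₂ λ u u<1+t → [ none u , (λ { refl → ¬q }) ] (m<1+n⇒m<n∨m≡n u<1+t)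

Between : ℕ → ℕ → ℕ → Set
Between a b r = a ⊓ b ≤ r × r ≤ a ⊔ b

betweenUp : ∀ {a b r} → a ≤ r → r ≤ b → Between a b r
betweenUp {a} {b} a≤r r≤b = ≤-trans (m⊓n≤m a b) a≤r , ≤-trans r≤b (m≤n⊔m a b)

betweenDown : ∀ {a b r} → b ≤ r → r ≤ a → Between a b r
betweenDown {a} {b} b≤r r≤a = ≤-trans (m⊓n≤n a b) b≤r , ≤-trans r≤a (m≤m⊔n a b)

inBox : ∀ {u q r : Point} → Between (proj₁ u) (proj₁ q) (proj₁ r) →
        Between (proj₂ u) (proj₂ q) (proj₂ r) → InBox u q r
inBox (x₁ , x₂) (t₁ , t₂) = x₁ , x₂ , t₁ , t₂

module KeySets {n m : ℕ} (S : UpdSeq n m) where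
  open UpdSeq S

  keyStep : ∀ t {x} → K S t x → K S (suc t) x ⊎ (op (suc t) ≡ delete × s (suc t) ≡ x)
  keyStep t {x} k with op (suc t)
  ... | insert = inj₁ (inj₂ k)
  ... | access = inj₁ k
  ... | delete with s (suc t) ≟ x
  ...   | yes e = inj₂ (refl , e)
  ...   | no ne = inj₁ (k , λ e → ne (sym e))

  insertedKey : ∀ {t} → 1 ≤ t → op t ≡ insert → K S t (s t)
  insertedKey {suc t} _ isIns with op (suc t)
  insertedKey {suc t} _ refl | insert = inj₁ refl

  insertStep : ∀ t {x} → op (suc t) ≡ insert → K S (suc t) x → x ≡ s (suc t) ⊎ K S t x
  insertStep t eq k with op (suc t)
  insertStep t refl k | insert = k

  deleteStep : ∀ t {x} → op (suc t) ≡ delete → K S (suc t) x → K S t x × x ≢ s (suc t)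
  deleteStep t eq k with op (suc t)
  deleteStep t refl k | delete = k

  DeletedIn : ℕ → ℕ → ℕ → Set
  DeletedIn x t₁ t₂ =
    Σ ℕ λ t' → t₁ ≤ t' × suc t' ≤ t₂ × op (suc t') ≡ delete × s (suc t') ≡ x

  keyOrDeleted : ∀ {t₁ t₂ x} → t₁ ≤′ t₂ → K S t₁ x → K S t₂ x ⊎ DeletedIn x t₁ t₂
  keyOrDeleted (≤′-reflexive refl) k = inj₁ k
  keyOrDeleted {t₂ = suc t} (≤′-step le) k with keyOrDeleted le k
  ... | inj₂ (t' , t₁≤t' , t'<t , del , sx) =
        inj₂ (t' , t₁≤t' , m≤n⇒m≤1+n t'<t , del , sx)
  ... | inj₁ kt with keyStep t kt
  ...   | inj₁ k′ = inj₁ k′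
  ...   | inj₂ (del , sx) = inj₂ (t , ≤′⇒≤ le , ≤-refl , del , sx)

  keyPersists : ∀ {t₁ t₂ x} → t₁ ≤ t₂ → K S t₁ x → (∀ u → t₁ < u → u ≤ t₂ → s u ≢ x) →
                K S t₂ x
  keyPersists t₁≤t₂ k untouched with keyOrDeleted (≤⇒≤′ t₁≤t₂) k
  ... | inj₁ k′ = k′
  ... | inj₂ (t' , t₁≤t' , t'<t₂ , _ , sx) =
        ⊥-elim (untouched (suc t') (s≤s t₁≤t') t'<t₂ sx)

  -- The key set relevant to the update at time t: K(t) after an insertion,
  -- K(t − 1) before a deletion.
  keyTimeOf : Op → ℕ → ℕ
  keyTimeOf delete t = pred t
  keyTimeOf _      t = t

  keyTime : ℕ → ℕ
  keyTime t = keyTimeOf (op t) t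

  -- keyTime t is t or t − 1, hence monotone.
  keyTime≤ : ∀ t → keyTime t ≤ t
  keyTime≤ t with op t
  ... | insert = ≤-refl
  ... | delete = pred[n]≤n
  ... | access = ≤-refl

  pred≤keyTime : ∀ t → pred t ≤ keyTime t
  pred≤keyTime t with op t
  ... | insert = pred[n]≤n
  ... | delete = ≤-refl
  ... | access = pred[n]≤n

  keyTime-mono : ∀ {t t'} → t ≤ t' → keyTime t ≤ keyTime t'
  keyTime-mono {t} {t'} t≤t' with m≤n⇒m<n∨m≡n t≤t'
  ... | inj₂ refl = ≤-refl
  ... | inj₁ t<t' = ≤-trans (keyTime≤ t) (≤-trans (<⇒≤pred t<t') (pred≤keyTime t'))

  keyAtKeyTime : ∀ t {x} → K S t x → K S (keyTime t) x
  keyAtKeyTime zero k with op zero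
  ... | insert = k
  ... | delete = k
  ... | access = k
  keyAtKeyTime (suc t) {x} = byOperation (op (suc t)) refl
    where
    byOperation : ∀ o → op (suc t) ≡ o → K S (suc t) x → K S (keyTimeOf o (suc t)) x
    byOperation insert _ k = k
    byOperation delete isDel k = proj₁ (deleteStep t isDel k)
    byOperation access _ k = k

-- Deque sequences: the updated element is extreme

module DequeKeys {n m : ℕ} (S : UpdSeq n m) (dq : Deque S) where
  open UpdSeq S
  open KeySets S

  noAccess : ∀ t → InTime S t → op t ≢ access
  noAccess = proj₁ dq

  deleteExtreme : ∀ t → suc t ≤ m → op (suc t) ≡ delete →
                  IsMin (K S t) (s (suc t)) ⊎ IsMax (K S t) (s (suc t))
  deleteExtreme = proj₂ (proj₂ dq)

  insertExtreme : ∀ t → InTime S t → op t ≡ insert → IsMin (K S t) (s t) ⊎ IsMax (K S t) (s t)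
  insertExtreme = proj₁ (proj₂ dq)

  extreme : ∀ t → InTime S t →
            IsMin (K S (keyTime t)) (s t) ⊎ IsMax (K S (keyTime t)) (s t)
  extreme zero (() , _)
  extreme (suc t) it with op (suc t) in eq
  ... | insert = insertExtreme (suc t) it eq
  ... | delete = deleteExtreme t (proj₂ it) eq
  ... | access = ⊥-elim (noAccess (suc t) it eq)

  updatedKey : ∀ t → InTime S t → K S (keyTime t) (s t)
  updatedKey t it = [ proj₁ , proj₁ ] (extreme t it)

  separates : ∀ t {y z} → InTime S t → K S (keyTime t) y → K S (keyTime t) z →
              s t ≤ y ⊎ z ≤ s t
  separates t {y} {z} it ky kz =
    [ (λ isMin → inj₁ (proj₂ isMin y ky)) , (λ isMax → inj₂ (proj₂ isMax z kz)) ]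
    (extreme t it)

  updatePoint : ∀ {x t} → InTime S t → s t ≡ x → Upt S (x , t)
  updatePoint {x} {t} it sx with op t in eq
  ... | insert = inj₁ (it , sx , refl)
  ... | delete = inj₂ (it , sx , refl)
  ... | access = ⊥-elim (noAccess t it eq)

  updateElement : ∀ {x t} → Upt S (x , t) → s t ≡ x
  updateElement (inj₁ (_ , sx , _)) = sx
  updateElement (inj₂ (_ , sx , _)) = sx

-- Valid points off the updated column are keys

module ValidKeys {n m : ℕ} (S : UpdSeq n m) (dq : Deque S) (occ : AllOccur S) where
  open UpdSeq S
  open KeySets S
  open DequeKeys S dq

  UpdatedAt : ℕ → ℕ → Set
  UpdatedAt x u = 1 ≤ u × s u ≡ x

  untouchedUpTo : ∀ {t₁ t x} → (∀ u → t₁ < u → u < t → s u ≢ x) → s t ≢ x →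
                  ∀ u → t₁ < u → u ≤ t → s u ≢ x
  untouchedUpTo before now u t₁<u u≤t with m≤n⇒m<n∨m≡n u≤t
  ... | inj₁ u<t = before u t₁<u u<t
  ... | inj₂ refl = now

  laterUpdate : ∀ {x t} → InRange n x → (∀ u → u < t → ¬ UpdatedAt x u) → s t ≢ x →
                Σ ℕ λ t₀ → t < t₀ × t₀ ≤ m × s t₀ ≡ x
  laterUpdate {x} {t} inRange none ne with occ x inRange
  ... | (t₀ , (1≤t₀ , t₀≤m) , sx) with <-cmp t₀ t
  ...   | tri< t₀<t _ _ = ⊥-elim (none t₀ t₀<t (1≤t₀ , sx))
  ...   | tri≈ _ refl _ = ⊥-elim (ne sx)
  ...   | tri> _ _ t<t₀ = t₀ , t<t₀ , t₀≤m , sx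

  keyAfterInsertion : ∀ {x t} → t ≤ m → PrevIn S (Ipt S) (x , t) → s t ≢ x →
    (Σ ℕ λ t' → t' < t × UpdatedAt x t' × (∀ u → t' < u → u < t → ¬ UpdatedAt x u)) →
    K S t x
  keyAfterInsertion {x} {t} t≤m prevIns ne (t' , t'<t , (1≤t' , sx) , gap) =
    keyPersists (<⇒≤ t'<t) (subst (K S t') sx (insertedKey 1≤t' isInsertion))
      (untouchedUpTo (λ u t'<u u<t e → gap u t'<u u<t (≤-trans 1≤t' (<⇒≤ t'<u) , e)) ne)
    where
    prev : PrevU S (x , t) (x , t')
    prev = updatePoint (1≤t' , ≤-trans (<⇒≤ t'<t) t≤m) sx , refl , t'<t ,
           λ u t'<u u<t up → gap u t'<u u<t (≤-trans 1≤t' (<⇒≤ t'<u) , updateElement up)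
    isInsertion : op t' ≡ insert
    isInsertion = proj₂ (proj₂ (prevIns (x , t') prev))

  -- If x is not updated up to time t and its next update is a deletion,
  -- then x was a key from the start and still is at t.
  keyFromStart : ∀ {x t} → InRange n x → InTime S t → NextIn S (Dpt S) (x , t) → s t ≢ x →
    (∀ u → u < t → ¬ UpdatedAt x u) → K S t x
  keyFromStart {x} {t} inRange (1≤t , _) nextDel ne none
    with laterUpdate inRange none ne
  ... | (t₀ , t<t₀ , t₀≤m , sx₀)
        with Search.firstBelow (λ u → (t <? u) ×-dec (s u ≟ x)) (suc t₀)
  ...   | inj₂ none′ = ⊥-elim (none′ t₀ (n<1+n t₀) (t<t₀ , sx₀))
  ...   | inj₁ (t' , t'≤t₀ , (t<t' , sx) , earliest) =
          keyPersists z≤n initial (untouchedUpTo (λ u 0<u u<t e → none u u<t (0<u , e)) ne)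
    where
    inTime' : InTime S t'
    inTime' = ≤-trans 1≤t (<⇒≤ t<t') , ≤-trans (≤-pred t'≤t₀) t₀≤m
    next : NextU S (x , t) (x , t')
    next = updatePoint inTime' sx , refl , t<t' ,
           λ u t<u u<t' up → earliest u u<t' (t<u , updateElement up)
    notBefore : ∀ u → 1 ≤ u → u < t' → s u ≢ x
    notBefore u 1≤u u<t' e with <-cmp u t
    ... | tri< u<t _ _ = none u u<t (1≤u , e)
    ... | tri≈ _ refl _ = ne e
    ... | tri> _ _ t<u = earliest u u<t' (t<u , e)
    initial : K S 0 x
    initial = inRange , delete ,
              (t' , inTime' , sx , proj₂ (proj₂ (nextDel (x , t') next)) , notBefore) , λ ()

  -- A valid point (x , t) off the updated column has x ∈ K(t): validity
  -- says the previous update of x is an insertion and the next a deletion.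
  validKey : ∀ {x t} → Valid S (x , t) → s t ≢ x → K S t x
  validKey (_ , _ , inj₂ (inj₁ (ins , _))) ne = ⊥-elim (ne (proj₁ (proj₂ ins)))
  validKey (_ , _ , inj₂ (inj₂ (del , _))) ne = ⊥-elim (ne (proj₁ (proj₂ del)))
  validKey {x} {t} (inRange , inTime , inj₁ (_ , prevIns , nextDel)) ne
    with Search.lastBelow (λ u → (1 ≤? u) ×-dec (s u ≟ x)) t
  ... | inj₁ last = keyAfterInsertion (proj₂ inTime) prevIns ne last
  ... | inj₂ none = keyFromStart inRange inTime nextDel ne none

-- Concentrated deque sequences: deleted elements stay outside the keys

splitLast : ∀ (F : ℕ → Set) t → (∃ λ t' → suc t' < suc (suc t) × F t') →
            (∃ λ t' → suc t' < suc t × F t') ⊎ F t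
splitLast F t (t' , lt , f) with m<1+n⇒m<n∨m≡n lt
... | inj₁ lt′ = inj₁ (t' , lt′ , f)
... | inj₂ refl = inj₂ f

module Concentration {n m : ℕ} (S : UpdSeq n m) (dq : Deque S) (conc : Concentrated S) where
  open UpdSeq S
  open KeySets S
  open DequeKeys S dq

  Separated : ℕ → Set
  Separated t = (∀ y k → L S (suc t) y → K S t k → y < k) ×
                (∀ y k → R S (suc t) y → K S t k → k < y)

  -- A key inserted at time suc t lies above every element of L(suc t): if
  -- it did not, it would be the minimum of K(suc t), and concentration
  -- would put it above L(suc t) after all.
  insertedAboveL : ∀ t → suc t ≤ m → op (suc t) ≡ insert → Separated t →
                   ∀ y → L S (suc t) y → y < s (suc t)
  insertedAboveL t sucT≤m isIns (belowL , _) y l with y <? s (suc t)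
  ... | yes y<x = y<x
  ... | no y≮x = proj₁ (conc (suc t) (s≤s z≤n , sucT≤m) isIns) isMin y l
    where
    isMin : IsMin (K S (suc t)) (s (suc t))
    isMin = insertedKey (s≤s z≤n) isIns , λ z kz →
      [ (λ z≡x → ≤-reflexive (sym z≡x))
      , (λ kt → <⇒≤ (≤-<-trans (≮⇒≥ y≮x) (belowL y z l kt))) ]
      (insertStep t isIns kz)

  insertedBelowR : ∀ t → suc t ≤ m → op (suc t) ≡ insert → Separated t →
                   ∀ y → R S (suc t) y → s (suc t) < y
  insertedBelowR t sucT≤m isIns (_ , aboveR) y r with s (suc t) <? y
  ... | yes x<y = x<y
  ... | no x≮y = proj₂ (conc (suc t) (s≤s z≤n , sucT≤m) isIns) isMax y r
    where
    isMax : IsMax (K S (suc t)) (s (suc t))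
    isMax = insertedKey (s≤s z≤n) isIns , λ z kz →
      [ ≤-reflexive , (λ kt → <⇒≤ (<-≤-trans (aboveR y z r kt) (≮⇒≥ x≮y))) ]
      (insertStep t isIns kz)

  -- An insertion keeps the separation: L and R are unchanged and the new
  -- key respects them.
  insertKeepsSeparated : ∀ t → suc t ≤ m → op (suc t) ≡ insert → Separated t →
                         Separated (suc t)
  insertKeepsSeparated t sucT≤m isIns sep@(belowL , aboveR) = newBelow , newAbove
    where
    notDeleted : ∀ {A : Set} → op (suc t) ≡ delete → A
    notDeleted isDel = ⊥-elim (insert≢delete (trans (sym isIns) isDel))
      where
      insert≢delete : insert ≢ delete
      insert≢delete ()
    newBelow : ∀ y k → L S (suc (suc t)) y → K S (suc t) k → y < k
    newBelow y k l kk with splitLast _ t l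
    ... | inj₂ (isDel , _) = notDeleted isDel
    ... | inj₁ l′ with insertStep t isIns kk
    ...   | inj₁ refl = insertedAboveL t sucT≤m isIns sep y l′
    ...   | inj₂ kt = belowL y k l′ kt
    newAbove : ∀ y k → R S (suc (suc t)) y → K S (suc t) k → k < y
    newAbove y k r kk with splitLast _ t r
    ... | inj₂ (isDel , _) = notDeleted isDel
    ... | inj₁ r′ with insertStep t isIns kk
    ...   | inj₁ refl = insertedBelowR t sucT≤m isIns sep y r′
    ...   | inj₂ kt = aboveR y k r′ kt

  -- A deletion keeps the separation: the deleted element was the minimum
  -- (it joins L) or the maximum (it joins R) of K(t).
  deleteKeepsSeparated : ∀ t → suc t ≤ m → op (suc t) ≡ delete → Separated t → Separated (suc t)
  deleteKeepsSeparated t sucT≤m isDel (belowL , aboveR) = newBelow , newAbove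
    where
    newBelow : ∀ y k → L S (suc (suc t)) y → K S (suc t) k → y < k
    newBelow y k l kk with deleteStep t isDel kk | splitLast _ t l
    ... | (kt , _) | inj₁ l′ = belowL y k l′ kt
    ... | (kt , k≢x) | inj₂ (_ , refl , isMin) = ≤∧≢⇒< (proj₂ isMin k kt) (λ e → k≢x (sym e))
    newAbove : ∀ y k → R S (suc (suc t)) y → K S (suc t) k → k < y
    newAbove y k r kk with deleteStep t isDel kk | splitLast _ t r
    ... | (kt , _) | inj₁ r′ = aboveR y k r′ kt
    ... | (kt , k≢x) | inj₂ (_ , refl , notMin) with deleteExtreme t sucT≤m isDel
    ...   | inj₁ isMin = ⊥-elim (notMin isMin)
    ...   | inj₂ isMax = ≤∧≢⇒< (proj₂ isMax k kt) k≢x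

  separated : ∀ t → t ≤ m → Separated t
  separated zero _ = (λ { _ _ (_ , s≤s () , _) _ }) , (λ { _ _ (_ , s≤s () , _) _ })
  separated (suc t) sucT≤m = byOperation (op (suc t)) refl
    where
    previous : Separated t
    previous = separated t (≤-trans (n≤1+n t) sucT≤m)
    byOperation : ∀ o → op (suc t) ≡ o → Separated (suc t)
    byOperation insert isIns = insertKeepsSeparated t sucT≤m isIns previous
    byOperation delete isDel = deleteKeepsSeparated t sucT≤m isDel previous
    byOperation access isAcc = ⊥-elim (noAccess (suc t) (s≤s z≤n , sucT≤m) isAcc)

  -- Survival: a key of K(t₁) lying between two keys of a later K(t₂) is a
  -- key at every time in between, since a deletion would put it in L or R.
  keySurvives : ∀ {t₁ t₂ t x y z} → t₂ ≤ m → K S t₁ x → K S t₂ y → K S t₂ z →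
                y < x → x < z → t₁ ≤ t → t ≤ t₂ → K S t x
  keySurvives {t₂ = t₂} t₂≤m kx ky kz y<x x<z t₁≤t t≤t₂
    with keyOrDeleted (≤⇒≤′ t₁≤t) kx
  ... | inj₁ kt = kt
  ... | inj₂ (t' , _ , t'<t , isDel , refl) =
        ⊥-elim (<-asym x<z (aboveR _ _ (t' , early , isDel , refl , notMin) kz))
    where
    belowL : ∀ y k → L S (suc t₂) y → K S t₂ k → y < k
    belowL = proj₁ (separated t₂ t₂≤m)
    aboveR : ∀ y k → R S (suc t₂) y → K S t₂ k → k < y
    aboveR = proj₂ (separated t₂ t₂≤m)
    early : suc t' < suc t₂
    early = s≤s (≤-trans t'<t t≤t₂)
    notMin : ¬ IsMin (K S t') (s (suc t'))
    notMin isMin = <-asym y<x (belowL _ _ (t' , early , isDel , refl , isMin) ky)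

module GreedyRows {n m : ℕ} (S : UpdSeq n m) (dq : Deque S) (occ : AllOccur S)
                  (P : PointSet) (gr : Greedy S P) where
  open UpdSeq S
  open KeySets S
  open DequeKeys S dq
  open ValidKeys S dq occ

  inTimeOf : ∀ {p} → P p → InTime S (proj₂ p)
  inTimeOf = proj₁ gr _

  activeValid : ∀ {q u} → ActivePair S q u → Valid S (proj₁ q , proj₂ u)
  activeValid (q≤u , bothActive) = proj₁ (bothActive _ q≤u ≤-refl) _ (m⊓n≤n _ _) (m≤n⊔m _ _)

  neighbourKey : ∀ t {x} → Valid S (x , t) → x ≢ s t → K S (keyTime t) x
  neighbourKey t valid x≢st = keyAtKeyTime t (validKey valid (λ e → x≢st (sym e)))

  -- Since s t is extreme among these keys, pred(s t , t) and succ(s t , t)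
  -- never both exist.
  noTwoNeighbours : ∀ t → InTime S t →
                    ¬ ((∃ λ r → Pred S (s t , t) r) × (∃ λ r → Succ S (s t , t) r))
  noTwoNeighbours t it (((l , .t) , refl , l<st , vl , _) , ((r , .t) , refl , st<r , vr , _))
    with separates t it (neighbourKey t vl (<⇒≢ l<st)) (neighbourKey t vr (>⇒≢ st<r))
  ... | inj₁ st≤l = <⇒≱ l<st st≤l
  ... | inj₂ r≤st = <⇒≱ st<r r≤st

  stairColumn : ∀ {x t} → P (x , t) → Cols (Stair S P (s t , t)) x
  stairColumn {x} {t} p =
    proj₁ (proj₁ (proj₂ gr t (inTimeOf p)) (inj₂ (noTwoNeighbours t (inTimeOf p))) x) p

  Supported : ℕ → ℕ → Set
  Supported t x = Σ Point λ q → proj₁ q ≡ x × P q × proj₂ q < t × ActivePair S q (s t , t) ×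
                    (∀ r → P r → proj₂ r < t → InBox (s t , t) q r → r ≡ q)

  rowPoint : ∀ {x t} → P (x , t) → x ≡ s t ⊎ Supported t x
  rowPoint p with stairColumn p
  ... | (q , inj₁ refl , qx) = inj₁ (sym qx)
  ... | (q , inj₂ (Pq , q<t , active , empty) , qx) = inj₂ (q , qx , Pq , q<t , active , empty)

  rowKey : ∀ {x t} → P (x , t) → K S (keyTime t) x
  rowKey {x} {t} p with x ≟ s t
  ... | yes refl = updatedKey t (inTimeOf p)
  ... | no x≢st with rowPoint p
  ...   | inj₁ x≡st = ⊥-elim (x≢st x≡st)
  ...   | inj₂ (q , refl , _ , _ , active , _) = neighbourKey t (activeValid active) x≢st

module Avoidance {n m : ℕ} (S : UpdSeq n m) (dq : Deque S) (occ : AllOccur S)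
                 (conc : Concentrated S) (P : PointSet) (gr : Greedy S P) where
  open UpdSeq S
  open KeySets S
  open DequeKeys S dq
  open Concentration S dq conc
  open GreedyRows S dq occ P gr

  noPointBetween : ∀ {a b c d e τ T} →
                   P (a , T) → P (b , τ) → P (c , T) → P (d , τ) → P (e , T) →
                   a < b → b < c → c < d → d < e → ∀ t → τ < t → t ≤ T → ¬ P (c , t)
  noPointBetween {a} {b} {c} {d} {e} {τ} {T} Pa Pb Pc Pd Pe a<b b<c c<d d<e =
    <-rec (λ t → τ < t → t ≤ T → ¬ P (c , t)) descend
    where
    flankedKey : ∀ {x y z t} → K S (keyTime τ) x → K S (keyTime T) y → K S (keyTime T) z →
                 y < x → x < z → τ ≤ t → t ≤ T → K S (keyTime t) x
    flankedKey kx ky kz y<x x<z τ≤t t≤T =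
      keySurvives (≤-trans (keyTime≤ T) (proj₂ (inTimeOf Pc))) kx ky kz y<x x<z
        (keyTime-mono τ≤t) (keyTime-mono t≤T)

    outside : ∀ t → τ ≤ t → t ≤ T → InTime S t → s t ≤ b ⊎ d ≤ s t
    outside t τ≤t t≤T it =
      separates t it (flankedKey (rowKey Pb) (rowKey Pa) (rowKey Pc) a<b b<c τ≤t t≤T)
                     (flankedKey (rowKey Pd) (rowKey Pc) (rowKey Pe) c<d d<e τ≤t t≤T)

    descend : ∀ t → (∀ {t'} → t' < t → τ < t' → t' ≤ T → ¬ P (c , t')) →
              τ < t → t ≤ T → ¬ P (c , t)
    descend t below τ<t t≤T Pct with outside t (<⇒≤ τ<t) t≤T (inTimeOf Pct) | rowPoint Pct
    ... | inj₁ st≤b | inj₁ refl = <⇒≱ b<c st≤b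
    ... | inj₂ d≤st | inj₁ refl = <⇒≱ c<d d≤st
    ... | side | inj₂ ((.c , t') , refl , Pq , t'<t , _ , empty) with τ <? t'
    ...   | yes τ<t' = below t'<t τ<t' (≤-trans (<⇒≤ t'<t) t≤T) Pq
    ...   | no τ≮t' = blocked side
      where
      rows : Between t t' τ
      rows = betweenDown (≮⇒≥ τ≮t') (<⇒≤ τ<t)
      -- the empty box of (s t , t) and (c , t') would contain (b , τ) or (d , τ)
      blocked : s t ≤ b ⊎ d ≤ s t → ⊥
      blocked (inj₁ st≤b) =
        <⇒≢ b<c (cong proj₁ (empty (b , τ) Pb τ<t (inBox (betweenUp st≤b (<⇒≤ b<c)) rows)))
      blocked (inj₂ d≤st) =
        >⇒≢ c<d (cong proj₁ (empty (d , τ) Pd τ<t (inBox (betweenDown (<⇒≤ c<d) d≤st) rows)))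

lemma29 : ∀ (n m : ℕ) (S : UpdSeq n m) → Standing S → Deque S → Concentrated S →
    (P : PointSet) → Greedy S P →
    ¬ (Σ Point λ a → Σ Point λ b → Σ Point λ c → Σ Point λ d → Σ Point λ e →
         P a × P b × P c × P d × P e ×
         proj₁ a < proj₁ b × proj₁ b < proj₁ c × proj₁ c < proj₁ d × proj₁ d < proj₁ e ×
         proj₂ a ≡ proj₂ c × proj₂ c ≡ proj₂ e × proj₂ b ≡ proj₂ d × proj₂ b < proj₂ a)
lemma29 n m S (_ , _ , occ) dq conc P gr
  ((a , T) , (b , τ) , (c , .T) , (d , .τ) , (e , .T) ,
   Pa , Pb , Pc , Pd , Pe , a<b , b<c , c<d , d<e , refl , refl , refl , τ<T) =
  noPointBetween Pa Pb Pc Pd Pe a<b b<c c<d d<e T τ<T ≤-refl Pc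
  where open Avoidance S dq occ conc P gr
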